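{- Let $G$ be a simple cubic graph. If $\mathcal C$ is a $3$-cycle of $G$, then $\mathcal C$ is a facial cycle in every polyhedral embedding of $G$.
   Context: An embedding of a graph in a surface without boundary is polyhedral if every facial walk (boundary walk of a face) is a cycle and any two distinct facial cycles intersect in either the empty set, a single vertex, or a single edge. -}

module Defs where

open import Data.Nat using (ℕ; zero; suc; _≤_; _<_)
open import Data.Fin using (Fin)
open import Data.Product using (Σ; ∃; _×_; _,_)
open import Data.Sum using (_⊎_)
open import Relation.Binary.PropositionalEquality using (_≡_; _≢_)
open import Relation.Nullary using (¬_)

record SimpleGraph (n : ℕ) : Set₁ where
  field
    Adj     : Fin n → Fin n → Set
    sym     : ∀ {a b} → Adj a b → Adj b a
    irrefl  : ∀ {a} → ¬ Adj a a

open SimpleGraph public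

Cubic : ∀ {n} → SimpleGraph n → Set
Cubic {n} G = ∀ (a : Fin n) → Σ (Fin n) λ b → Σ (Fin n) λ c → Σ (Fin n) λ d →
  Adj G a b × Adj G a c × Adj G a d × b ≢ c × b ≢ d × c ≢ d ×
  (∀ e → Adj G a e → e ≡ b ⊎ e ≡ c ⊎ e ≡ d)

data Orbit₂ {m : ℕ} (f g : Fin m → Fin m) (x : Fin m) : Fin m → Set where
  here  : Orbit₂ f g x x
  viaf  : ∀ {y} → Orbit₂ f g x y → Orbit₂ f g x (f y)
  viag  : ∀ {y} → Orbit₂ f g x y → Orbit₂ f g x (g y)

data Orbit₃ {m : ℕ} (f g h : Fin m → Fin m) (x : Fin m) : Fin m → Set where
  here  : Orbit₃ f g h x x
  viaf  : ∀ {y} → Orbit₃ f g h x y → Orbit₃ f g h x (f y)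
  viag  : ∀ {y} → Orbit₃ f g h x y → Orbit₃ f g h x (g y)
  viah  : ∀ {y} → Orbit₃ f g h x y → Orbit₃ f g h x (h y)

iter : ∀ {A : Set} → (A → A) → ℕ → A → A
iter f zero    x = x
iter f (suc k) x = f (iter f k x)

-- Cellular embeddings of G in a closed (connected) surface, encoded as
-- graph-encoded maps (flag systems): flags Fin m with involutions
-- τ₀ (change vertex), τ₁ (change edge), τ₂ (change face).
-- Vertices = ⟨τ₁,τ₂⟩-orbits, edges = ⟨τ₀,τ₂⟩-orbits, faces = ⟨τ₀,τ₁⟩-orbits.
-- vtx identifies vertex-orbits bijectively with the vertices of G and
-- (via x ↦ {vtx x, vtx (τ₀ x)}) edge-orbits bijectively with edges of G.

record Embedding {n : ℕ} (G : SimpleGraph n) (m : ℕ) : Set where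
  field
    τ₀ τ₁ τ₂   : Fin m → Fin m
    invol₀     : ∀ x → τ₀ (τ₀ x) ≡ x
    invol₁     : ∀ x → τ₁ (τ₁ x) ≡ x
    invol₂     : ∀ x → τ₂ (τ₂ x) ≡ x
    fpf₀       : ∀ x → τ₀ x ≢ x
    fpf₁       : ∀ x → τ₁ x ≢ x
    fpf₂       : ∀ x → τ₂ x ≢ x
    comm₀₂     : ∀ x → τ₀ (τ₂ x) ≡ τ₂ (τ₀ x)
    fpf₀₂      : ∀ x → τ₀ (τ₂ x) ≢ x
    connected  : ∀ x y → Orbit₃ τ₀ τ₁ τ₂ x y
    vtx        : Fin m → Fin n
    vtx-τ₁     : ∀ x → vtx (τ₁ x) ≡ vtx x
    vtx-τ₂     : ∀ x → vtx (τ₂ x) ≡ vtx x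
    vtx-orbit  : ∀ x y → vtx x ≡ vtx y → Orbit₂ τ₁ τ₂ x y
    vtx-onto   : ∀ a → ∃ λ x → vtx x ≡ a
    edge-adj   : ∀ x → Adj G (vtx x) (vtx (τ₀ x))
    edge-onto  : ∀ a b → Adj G a b → ∃ λ x → vtx x ≡ a × vtx (τ₀ x) ≡ b
    edge-inj   : ∀ x y → vtx x ≡ vtx y → vtx (τ₀ x) ≡ vtx (τ₀ y) →
                 y ≡ x ⊎ y ≡ τ₂ x

module _ {n m : ℕ} {G : SimpleGraph n} (M : Embedding G m) where
  open Embedding M

  -- one step along the facial walk: flag at w_i with edge e_i ↦ flag at w_{i+1} with edge e_{i+1}
  ρ : Fin m → Fin m
  ρ x = τ₁ (τ₀ x)

  SameFace : Fin m → Fin m → Set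
  SameFace = Orbit₂ τ₀ τ₁

  FacialWalkIsCycle : Fin m → Set
  FacialWalkIsCycle x = Σ ℕ λ k → 3 ≤ k × iter ρ k x ≡ x ×
    (∀ i j → i < k → j < k → vtx (iter ρ i x) ≡ vtx (iter ρ j x) → i ≡ j)

  VertexOnFace : Fin m → Fin n → Set
  VertexOnFace x a = ∃ λ y → SameFace x y × vtx y ≡ a

  EdgeOnFace : Fin m → Fin n → Fin n → Set
  EdgeOnFace x a b = ∃ λ y → SameFace x y × vtx y ≡ a × vtx (τ₀ y) ≡ b

  CommonVertex : Fin m → Fin m → Fin n → Set
  CommonVertex x y a = VertexOnFace x a × VertexOnFace y a

  MeetProperly : Fin m → Fin m → Set
  MeetProperly x y =
      (∀ a → ¬ CommonVertex x y a)
    ⊎ (Σ (Fin n) λ a → ∀ c → (CommonVertex x y c → c ≡ a) × (c ≡ a → CommonVertex x y c))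
    ⊎ (Σ (Fin n) λ a → Σ (Fin n) λ b → a ≢ b ×
         EdgeOnFace x a b × EdgeOnFace y a b ×
         (∀ c → (CommonVertex x y c → c ≡ a ⊎ c ≡ b) × (c ≡ a ⊎ c ≡ b → CommonVertex x y c)))

  Polyhedral : Set
  Polyhedral = (∀ x → FacialWalkIsCycle x) ×
               (∀ x y → ¬ SameFace x y → MeetProperly x y)

  IsFacialTriangle : Fin n → Fin n → Fin n → Set
  IsFacialTriangle a b c = ∃ λ x →
    vtx x ≡ a × vtx (ρ x) ≡ b × vtx (ρ (ρ x)) ≡ c × ρ (ρ (ρ x)) ≡ x

module Submission where

-- Write nbr x = vtx (τ₀ x) for the far end of
-- the edge of the flag x; the walk x, τ₁ x, τ₁ (τ₂ x) turns around vtx x.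
--   * Faces are cycles, so the two flags x and τ₁ x of a face at a corner see
--     different neighbours, the only flags of the face of u at vtx u are u and
--     τ₁ u, hence τ₂ u lies on another face; and a facial walk returning to
--     its start vertex after two steps is a triangle.
--   * G is cubic, so the rotation at vtx w has three edges: the neighbours of
--     vtx w are exactly nbr w, nbr (τ₁ w) and nbr (τ₁ (τ₂ w)).
-- For the theorem take a flag u at a on the edge ab whose face turns to c at a
-- (replacing u by τ₂ u if needed).  At b this face either turns to c, and then
-- closes up into the triangle a b c, or it turns away from c; then the distinct
-- faces of u and τ₂ u share the three vertices a, b, c, which polyhedrality
-- forbids.

open import Defs
open import Data.Nat using (ℕ; zero; suc; _<_; z≤n; s≤s)
open import Data.Nat.Properties using (≤-trans; n<1+n; m<1+n⇒m<n∨m≡n; <⇒≤)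
open import Data.Fin using (Fin; _≟_)
open import Data.Product using (Σ; _×_; _,_; proj₁; proj₂)
open import Data.Sum using (_⊎_; inj₁; inj₂)
open import Data.Empty using (⊥; ⊥-elim)
open import Relation.Binary.PropositionalEquality
  using (_≡_; _≢_; refl; trans; cong; subst; ≢-sym)
  renaming (sym to ≡-sym)
open import Relation.Nullary using (¬_; yes; no)

In₂ : ∀ {A : Set} → A → A → A → Set
In₂ x y e = e ≡ x ⊎ e ≡ y

In₃ : ∀ {A : Set} → A → A → A → A → Set
In₃ x y z e = e ≡ x ⊎ e ≡ y ⊎ e ≡ z

no-three-in-two : ∀ {A : Set} {x y p q r : A} → In₂ x y p → In₂ x y q → In₂ x y r →
                  p ≢ q → p ≢ r → q ≢ r → ⊥
no-three-in-two (inj₁ refl) (inj₁ refl) _           p≢q _   _   = p≢q refl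
no-three-in-two (inj₂ refl) (inj₂ refl) _           p≢q _   _   = p≢q refl
no-three-in-two (inj₁ refl) (inj₂ refl) (inj₁ refl) _   p≢r _   = p≢r refl
no-three-in-two (inj₁ refl) (inj₂ refl) (inj₂ refl) _   _   q≢r = q≢r refl
no-three-in-two (inj₂ refl) (inj₁ refl) (inj₁ refl) _   _   q≢r = q≢r refl
no-three-in-two (inj₂ refl) (inj₁ refl) (inj₂ refl) _   p≢r _   = p≢r refl

drop-x : ∀ {A : Set} {x y z e : A} → In₃ x y z e → x ≢ e → In₂ y z e
drop-x (inj₁ refl) x≢e = ⊥-elim (x≢e refl)
drop-x (inj₂ e∈)   _   = e∈

drop-y : ∀ {A : Set} {x y z e : A} → In₃ x y z e → y ≢ e → In₂ x z e
drop-y (inj₁ e≡x)         _   = inj₁ e≡x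
drop-y (inj₂ (inj₁ refl)) y≢e = ⊥-elim (y≢e refl)
drop-y (inj₂ (inj₂ e≡z))  _   = inj₂ e≡z

drop-z : ∀ {A : Set} {x y z e : A} → In₃ x y z e → z ≢ e → In₂ x y e
drop-z (inj₁ e≡x)         _   = inj₁ e≡x
drop-z (inj₂ (inj₁ e≡y))  _   = inj₂ e≡y
drop-z (inj₂ (inj₂ refl)) z≢e = ⊥-elim (z≢e refl)

no-four-in-three : ∀ {A : Set} {x y z p s t q : A} →
                   In₃ x y z p → In₃ x y z s → In₃ x y z t → In₃ x y z q →
                   p ≢ s → p ≢ t → p ≢ q → s ≢ t → s ≢ q → t ≢ q → ⊥
no-four-in-three (inj₁ refl) s∈ t∈ q∈ p≢s p≢t p≢q s≢t s≢q t≢q =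
  no-three-in-two (drop-x s∈ p≢s) (drop-x t∈ p≢t) (drop-x q∈ p≢q) s≢t s≢q t≢q
no-four-in-three (inj₂ (inj₁ refl)) s∈ t∈ q∈ p≢s p≢t p≢q s≢t s≢q t≢q =
  no-three-in-two (drop-y s∈ p≢s) (drop-y t∈ p≢t) (drop-y q∈ p≢q) s≢t s≢q t≢q
no-four-in-three (inj₂ (inj₂ refl)) s∈ t∈ q∈ p≢s p≢t p≢q s≢t s≢q t≢q =
  no-three-in-two (drop-z s∈ p≢s) (drop-z t∈ p≢t) (drop-z q∈ p≢q) s≢t s≢q t≢q

adjacent-distinct : ∀ {n} (G : SimpleGraph n) {x y : Fin n} → Adj G x y → x ≢ y
adjacent-distinct G xy refl = irrefl G xy

module CubicGraph {n : ℕ} (G : SimpleGraph n) (cubic : Cubic G) where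

  neighbourhood-not-in-two : ∀ v {x y} → (∀ e → Adj G v e → In₂ x y e) → ⊥
  neighbourhood-not-in-two v ⊆xy with cubic v
  ... | b , c , d , vb , vc , vd , b≢c , b≢d , c≢d , _ =
    no-three-in-two (⊆xy b vb) (⊆xy c vc) (⊆xy d vd) b≢c b≢d c≢d

  neighbours-exhausted : ∀ {v p s t} q → Adj G v p → Adj G v s → Adj G v t → Adj G v q →
                         p ≢ s → p ≢ t → s ≢ t → q ≢ p → q ≡ s ⊎ q ≡ t
  neighbours-exhausted {v} {p} {s} {t} q vp vs vt vq p≢s p≢t s≢t q≢p with q ≟ s | q ≟ t
  ... | yes q≡s | _       = inj₁ q≡s
  ... | no _    | yes q≡t = inj₂ q≡t
  ... | no q≢s  | no q≢t  with cubic v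
  ...   | _ , _ , _ , _ , _ , _ , _ , _ , _ , cover =
    ⊥-elim (no-four-in-three (cover p vp) (cover s vs) (cover t vt) (cover q vq)
      p≢s p≢t (≢-sym q≢p) s≢t (≢-sym q≢s) (≢-sym q≢t))

commuting-involutions-orbit : ∀ {m} {f g : Fin m → Fin m} →
  (∀ x → f (f x) ≡ x) → (∀ x → g (g x) ≡ x) → ∀ w → f (g w) ≡ g (f w) →
  ∀ {z} → Orbit₂ f g w z → z ≡ w ⊎ z ≡ f w ⊎ z ≡ g w ⊎ z ≡ f (g w)
commuting-involutions-orbit ff gg w fg here = inj₁ refl
commuting-involutions-orbit ff gg w fg (viaf o) with commuting-involutions-orbit ff gg w fg o
... | inj₁ refl                 = inj₂ (inj₁ refl)
... | inj₂ (inj₁ refl)          = inj₁ (ff w)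
... | inj₂ (inj₂ (inj₁ refl))   = inj₂ (inj₂ (inj₂ refl))
... | inj₂ (inj₂ (inj₂ refl))   = inj₂ (inj₂ (inj₁ (ff _)))
commuting-involutions-orbit {g = g} ff gg w fg (viag o) with commuting-involutions-orbit ff gg w fg o
... | inj₁ refl                 = inj₂ (inj₂ (inj₁ refl))
... | inj₂ (inj₁ refl)          = inj₂ (inj₂ (inj₂ (≡-sym fg)))
... | inj₂ (inj₂ (inj₁ refl))   = inj₁ (gg w)
... | inj₂ (inj₂ (inj₂ refl))   = inj₂ (inj₁ (trans (cong g fg) (gg _)))

module Flags {n m : ℕ} {G : SimpleGraph n} (M : Embedding G m) where
  open Embedding M

  nbr : Fin m → Fin n
  nbr x = vtx (τ₀ x)

  nbr-τ₂ : ∀ x → nbr (τ₂ x) ≡ nbr x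
  nbr-τ₂ x = trans (cong vtx (comm₀₂ x)) (vtx-τ₂ (τ₀ x))

  edge-at : ∀ {x w} → vtx x ≡ vtx w → Adj G (vtx w) (nbr x)
  edge-at {x} x~w = subst (λ v → Adj G v (nbr x)) x~w (edge-adj x)

  commuting-corner-neighbours : ∀ w → τ₁ (τ₂ w) ≡ τ₂ (τ₁ w) →
                                ∀ e → Adj G (vtx w) e → In₂ (nbr w) (nbr (τ₁ w)) e
  commuting-corner-neighbours w comm e we with edge-onto (vtx w) e we
  ... | z , z~w , nz with commuting-involutions-orbit invol₁ invol₂ w comm
                            (vtx-orbit w z (≡-sym z~w))
  ... | inj₁ refl               = inj₁ (≡-sym nz)
  ... | inj₂ (inj₁ refl)        = inj₂ (≡-sym nz)
  ... | inj₂ (inj₂ (inj₁ refl)) = inj₁ (trans (≡-sym nz) (nbr-τ₂ w))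
  ... | inj₂ (inj₂ (inj₂ refl)) =
    inj₂ (trans (≡-sym nz) (trans (cong nbr comm) (nbr-τ₂ (τ₁ w))))

  module FacialWalk (y : Fin m) (k : ℕ) (returns : iter (ρ M) (suc k) y ≡ y) where

    walk : ℕ → Fin m
    walk i = iter (ρ M) i y

    OnWalk : Fin m → Set
    OnWalk z = Σ ℕ λ i → i < suc k × (z ≡ walk i ⊎ z ≡ τ₀ (walk i))

    τ₁-start : τ₁ y ≡ τ₀ (walk k)
    τ₁-start = trans (cong τ₁ (≡-sym returns)) (invol₁ _)

    τ₁-on-walk : ∀ i → i < suc k → OnWalk (τ₁ (τ₀ (walk i)))
    τ₁-on-walk i i≤k with m<1+n⇒m<n∨m≡n i≤k
    ... | inj₁ i<k  = suc i , s≤s i<k , inj₁ refl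
    ... | inj₂ refl = 0 , s≤s z≤n , inj₁ returns

    face-on-walk : ∀ {z} → SameFace M y z → OnWalk z
    face-on-walk here = 0 , s≤s z≤n , inj₁ refl
    face-on-walk (viaf o) with face-on-walk o
    ... | i , i≤k , inj₁ refl = i , i≤k , inj₂ refl
    ... | i , i≤k , inj₂ refl = i , i≤k , inj₁ (invol₀ _)
    face-on-walk (viag o) with face-on-walk o
    ... | zero  , _   , inj₁ refl = k , n<1+n k , inj₂ τ₁-start
    ... | suc i , i≤k , inj₁ refl = i , <⇒≤ i≤k , inj₂ (invol₁ _)
    ... | i     , i≤k , inj₂ refl = τ₁-on-walk i i≤k

  module CycleFaces (cycles : ∀ x → FacialWalkIsCycle M x) where

    nbr-τ₁ : ∀ x → nbr (τ₁ x) ≢ nbr x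
    nbr-τ₁ x same with cycles (τ₀ x)
    ... | k , 3≤k , _ , distinct with distinct 0 2 (≤-trans (s≤s z≤n) 3≤k) 3≤k back
      where
        back : vtx (τ₀ x) ≡ vtx (iter (ρ M) 2 (τ₀ x))
        back = ≡-sym (trans (vtx-τ₁ _) (trans (cong (λ z → nbr (τ₁ z)) (invol₀ x)) same))
    ... | ()

    corner-flags : ∀ u {z} → SameFace M u z → vtx u ≡ vtx z → z ≡ u ⊎ z ≡ τ₁ u
    corner-flags u o u~z with cycles u
    ... | zero , () , _
    ... | suc k , _ , returns , distinct = on-walk (face-on-walk o) u~z
      where
        open FacialWalk u k returns

        on-walk : ∀ {z} → OnWalk z → vtx u ≡ vtx z → z ≡ u ⊎ z ≡ τ₁ u
        on-walk (i , i≤k , inj₁ refl) u~z with distinct 0 i (s≤s z≤n) i≤k u~z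
        ... | refl = inj₁ refl
        on-walk (i , i≤k , inj₂ refl) u~z with m<1+n⇒m<n∨m≡n i≤k
        ... | inj₁ i<k with distinct 0 (suc i) (s≤s z≤n) (s≤s i<k) (trans u~z (≡-sym (vtx-τ₁ _)))
        ...   | ()
        on-walk (i , i≤k , inj₂ refl) u~z | inj₂ refl = inj₂ (≡-sym τ₁-start)

    τ₂-leaves-face : ∀ u → ¬ SameFace M u (τ₂ u)
    τ₂-leaves-face u o with corner-flags u o (≡-sym (vtx-τ₂ u))
    ... | inj₁ τ₂u≡u  = fpf₂ u τ₂u≡u
    ... | inj₂ τ₂u≡τ₁u = nbr-τ₁ u (trans (cong nbr (≡-sym τ₂u≡τ₁u)) (nbr-τ₂ u))

    triangle-closes : ∀ u → nbr (τ₁ u) ≡ vtx (ρ M (ρ M u)) → ρ M (ρ M (ρ M u)) ≡ u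
    triangle-closes u third with cycles u
    ... | zero , () , _
    ... | suc k , 3≤k , returns , distinct with distinct k 2 (n<1+n k) 3≤k last~third
      where
        open FacialWalk u k returns
        last~third : vtx (walk k) ≡ vtx (walk 2)
        last~third = trans (cong vtx (≡-sym (trans (cong τ₀ τ₁-start) (invol₀ _)))) third
    ... | refl = returns

  module CubicCycleFaces (cubic : Cubic G) (cycles : ∀ x → FacialWalkIsCycle M x) where
    open CubicGraph G cubic
    open CycleFaces cycles

    -- The two edges at vtx w other than that of w are distinct; otherwise
    -- τ₁ and τ₂ would commute at w and vtx w would have only two neighbours.
    rotation-distinct : ∀ w → nbr (τ₁ w) ≢ nbr (τ₁ (τ₂ w))
    rotation-distinct w same
      with edge-inj (τ₁ w) (τ₁ (τ₂ w))
             (trans (vtx-τ₁ w) (≡-sym (trans (vtx-τ₁ (τ₂ w)) (vtx-τ₂ w)))) same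
    ... | inj₁ τ₁τ₂w≡τ₁w = fpf₂ w (trans (≡-sym (invol₁ _)) (trans (cong τ₁ τ₁τ₂w≡τ₁w) (invol₁ w)))
    ... | inj₂ comm      = neighbourhood-not-in-two (vtx w) (commuting-corner-neighbours w comm)

    corner-neighbours : ∀ w {q} → Adj G (vtx w) q → q ≢ nbr w →
                        q ≡ nbr (τ₁ w) ⊎ q ≡ nbr (τ₁ (τ₂ w))
    corner-neighbours w {q} wq q≢w =
      neighbours-exhausted q (edge-adj w) (edge-at (vtx-τ₁ w))
        (edge-at (trans (vtx-τ₁ (τ₂ w)) (vtx-τ₂ w))) wq
        (≢-sym (nbr-τ₁ w))
        (λ e → nbr-τ₁ (τ₂ w) (≡-sym (trans (nbr-τ₂ w) e)))
        (rotation-distinct w) q≢w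

no-three-common-vertices : ∀ {n m} {G : SimpleGraph n} (M : Embedding G m) {x y : Fin m} {a b c : Fin n} →
  CommonVertex M x y a → CommonVertex M x y b → CommonVertex M x y c →
  a ≢ b → a ≢ c → b ≢ c → ¬ MeetProperly M x y
no-three-common-vertices M ca cb cc a≢b a≢c b≢c (inj₁ disjoint) = disjoint _ ca
no-three-common-vertices M ca cb cc a≢b a≢c b≢c (inj₂ (inj₁ (v , one))) =
  a≢b (trans (proj₁ (one _) ca) (≡-sym (proj₁ (one _) cb)))
no-three-common-vertices M ca cb cc a≢b a≢c b≢c (inj₂ (inj₂ (_ , _ , _ , _ , _ , two))) =
  no-three-in-two (proj₁ (two _) ca) (proj₁ (two _) cb) (proj₁ (two _) cc) a≢b a≢c b≢c

module PolyhedralCubic {n : ℕ} {G : SimpleGraph n} (cubic : Cubic G)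
                       {m : ℕ} (M : Embedding G m) (polyhedral : Polyhedral M) where
  open Embedding M
  open Flags M
  open CycleFaces (proj₁ polyhedral)
  open CubicCycleFaces cubic (proj₁ polyhedral)

  on-face : ∀ {x y} → SameFace M x y → VertexOnFace M x (vtx y)
  on-face {y = y} o = y , o , refl

  -- If the face of u runs c ← a → b along u, then a b c is a facial triangle:
  -- at b the face turns either to c, closing the triangle, or away from c,
  -- in which case the faces of u and τ₂ u would share a, b and c.
  corner-triangle : ∀ {a b c} → Adj G a b → Adj G b c → Adj G c a → ∀ u →
                    vtx u ≡ a → nbr u ≡ b → nbr (τ₁ u) ≡ c → IsFacialTriangle M a b c
  corner-triangle {a} {c = c} ab bc ca u refl refl u→c
    with corner-neighbours (τ₀ u) {c} bc (λ c≡a → adjacent-distinct G ca (trans c≡a a≡back))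
    where
      a≡back : nbr (τ₀ u) ≡ a
      a≡back = cong vtx (invol₀ u)
  ... | inj₁ turns-to-c =
    u , refl , vtx-τ₁ _ , third , triangle-closes u (trans u→c (≡-sym third))
    where
      third : vtx (ρ M (ρ M u)) ≡ c
      third = trans (vtx-τ₁ _) (≡-sym turns-to-c)
  ... | inj₂ turns-away = ⊥-elim
    (no-three-common-vertices M
      (on-face here , subst (VertexOnFace M (τ₂ u)) (vtx-τ₂ u) (on-face here))
      (on-face (viaf here) , subst (VertexOnFace M (τ₂ u)) (nbr-τ₂ u) (on-face (viaf here)))
      (subst (VertexOnFace M u) u→c (on-face (viaf (viag here))) ,
       subst (VertexOnFace M (τ₂ u)) c-via-τ₂ (on-face (viaf (viag (viaf here)))))
      (adjacent-distinct G ab) (≢-sym (adjacent-distinct G ca)) (adjacent-distinct G bc)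
      (proj₂ polyhedral u (τ₂ u) (τ₂-leaves-face u)))
    where
      c-via-τ₂ : nbr (τ₁ (τ₀ (τ₂ u))) ≡ c
      c-via-τ₂ = trans (cong (λ z → nbr (τ₁ z)) (comm₀₂ u)) (≡-sym turns-away)

  -- Every triangle a b c is facial: on a flag w at a along the edge ab, the
  -- face of w or of τ₂ w turns to c at a; apply corner-triangle to it.
  triangle-is-facial : ∀ {a b c} → Adj G a b → Adj G b c → Adj G c a → IsFacialTriangle M a b c
  triangle-is-facial {a} {b} ab bc ca with edge-onto a b ab
  ... | w , refl , w→b
    with corner-neighbours w (sym G ca) (λ c≡nbr → adjacent-distinct G bc (≡-sym (trans c≡nbr w→b)))
  ... | inj₁ w→c   = corner-triangle ab bc ca w refl w→b (≡-sym w→c)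
  ... | inj₂ τ₂w→c =
    corner-triangle ab bc ca (τ₂ w) (vtx-τ₂ w) (trans (nbr-τ₂ w) w→b) (≡-sym τ₂w→c)

proposition5 : ∀ {n : ℕ} (G : SimpleGraph n) → Cubic G →
    ∀ (a b c : Fin n) → Adj G a b → Adj G b c → Adj G c a →
    ∀ {m : ℕ} (M : Embedding G m) → Polyhedral M → IsFacialTriangle M a b c
proposition5 G cubic a b c ab bc ca M polyhedral = triangle-is-facial ab bc ca
  where open PolyhedralCubic cubic M polyhedral
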